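{- Let $G$ be a weighted graph, $a\in V(G)$, and $r_1,r_2\in A$. Let $G'$ be obtained from $G$ by changing the weights of $a$ to $\alpha'(a)=r_1\alpha(a)$ and $\beta'(a)=r_1\beta(a)+r_2$ (all other weights unchanged). Then $q(G')=r_1\,q(G)+r_2\,q(G-a)$.
   Context: All graphs are finite and may have loops (at most one per vertex) but no multiple edges. The adjacency matrix of a graph is the symmetric $0/1$ matrix over $GF(2)$ whose diagonal entry at $v$ is $1$ iff $v$ is looped; $r(G)$, $n(G)$ are its rank and nullity over $GF(2)$ (empty graph: $r=n=0$). For $S\subseteq V(G)$, $G[S]$ is the induced subgraph. Let $A$ be a commutative ring with unity containing elements $x,y$. A weighted graph is a graph $G$ with functions $\alpha,\beta:V(G)\to A$, and \[ q(G)=\sum_{S\subseteq V(G)}\Big(\prod_{s\in S}\alpha(s)\Big)\Big(\prod_{v\notin S}\beta(v)\Big)(x-1)^{r(G[S])}(y-1)^{n(G[S])}. \] $G-a$ keeps the weights of the remaining vertices. -}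

module Defs where

open import Level using (Level)
open import Data.Bool using (Bool; true; false; _∧_; _∨_; _xor_; not; if_then_else_)
open import Data.Nat using (ℕ; zero; suc; _⊔_; _∸_)
open import Data.Fin using (Fin; punchIn; _≟_)
open import Data.List using (List; []; _∷_; foldr; map; concatMap; allFin)
open import Relation.Nullary using (yes; no)
open import Relation.Binary.PropositionalEquality using (_≡_)
open import Algebra.Bundles using (CommutativeRing)

subsets : (n : ℕ) → List (Fin n → Bool)
subsets zero = (λ ()) ∷ []
subsets (suc n) = concatMap (λ f → cons false f ∷ cons true f ∷ []) (subsets n)
  where
  cons : {m : ℕ} → Bool → (Fin m → Bool) → Fin (suc m) → Bool
  cons b f Fin.zero = b
  cons b f (Fin.suc i) = f i

allV : (n : ℕ) → (Fin n → Bool) → Bool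
allV n p = foldr (λ i b → p i ∧ b) true (allFin n)

anyV : (n : ℕ) → (Fin n → Bool) → Bool
anyV n p = foldr (λ i b → p i ∨ b) false (allFin n)

xorV : (n : ℕ) → (Fin n → Bool) → Bool
xorV n p = foldr (λ i b → p i xor b) false (allFin n)

card : (n : ℕ) → (Fin n → Bool) → ℕ
card n S = foldr (λ i k → if S i then suc k else k) 0 (allFin n)

maxL : List ℕ → ℕ
maxL = foldr _⊔_ 0

-- Graphs (loops allowed, no multiple edges) on vertex set Fin n,
-- given by their symmetric 0/1 adjacency matrix over GF(2)
-- (diagonal entry = loop).

record Graph (n : ℕ) : Set where
  field
    adj : Fin n → Fin n → Bool
    adj-sym : ∀ i j → adj i j ≡ adj j i
open Graph public

-- Linear algebra over GF(2) for the principal submatrix on S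
-- (= adjacency matrix of the induced subgraph G[S]).
-- The rows indexed by T ⊆ S (restricted to the columns in S) are
-- linearly independent over GF(2) iff no nonempty U ⊆ T has
-- rows summing to the zero vector.
rowsIndependent : {n : ℕ} → Graph n → (S T : Fin n → Bool) → Bool
rowsIndependent {n} G S T =
  foldr (λ U b → b ∧
          (not (allV n (λ i → not (U i) ∨ T i))
           ∨ not (anyV n U)
           ∨ anyV n (λ j → S j ∧ xorV n (λ i → U i ∧ adj G i j))))
        true (subsets n)

-- r(G[S]): rank over GF(2) = maximal number of linearly independent rows
rankOn : {n : ℕ} → Graph n → (Fin n → Bool) → ℕ
rankOn {n} G S =
  maxL (map (λ T → if allV n (λ i → not (T i) ∨ S i) ∧ rowsIndependent G S T
                   then card n T else 0)
            (subsets n))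

nullityOn : {n : ℕ} → Graph n → (Fin n → Bool) → ℕ
nullityOn {n} G S = card n S ∸ rankOn G S

deleteG : {m : ℕ} → Graph (suc m) → Fin (suc m) → Graph m
deleteG G a = record
  { adj = λ i j → adj G (punchIn a i) (punchIn a j)
  ; adj-sym = λ i j → adj-sym G (punchIn a i) (punchIn a j) }

module _ {c ℓ : Level} (A : CommutativeRing c ℓ) where
  open CommutativeRing A

  record WGraph (n : ℕ) : Set c where
    field
      graph : Graph n
      α β : Fin n → Carrier
  open WGraph public

  pow : Carrier → ℕ → Carrier
  pow u zero = 1#
  pow u (suc k) = u * pow u k

  sumL : List Carrier → Carrier
  sumL = foldr _+_ 0#

  prodV : (n : ℕ) → (Fin n → Carrier) → Carrier
  prodV n f = foldr (λ i p → f i * p) 1# (allFin n)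

  q : (x y : Carrier) → {n : ℕ} → WGraph n → Carrier
  q x y {n} G = sumL (map term (subsets n))
    where
    term : (Fin n → Bool) → Carrier
    term S = prodV n (λ v → if S v then α G v else β G v)
           * pow (x - 1#) (rankOn (graph G) S)
           * pow (y - 1#) (nullityOn (graph G) S)

  deleteW : {m : ℕ} → WGraph (suc m) → Fin (suc m) → WGraph m
  deleteW G a = record
    { graph = deleteG (graph G) a
    ; α = λ i → α G (punchIn a i)
    ; β = λ i → β G (punchIn a i) }

  reweight : {n : ℕ} → WGraph n → Fin n → Carrier → Carrier → WGraph n
  reweight G a r₁ r₂ = record
    { graph = graph G
    ; α = λ v → case≟ v (r₁ * α G a) (α G v)
    ; β = λ v → case≟ v (r₁ * β G a + r₂) (β G v) }
    where
    case≟ : Fin _ → Carrier → Carrier → Carrier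
    case≟ v new old with v ≟ a
    ... | yes _ = new
    ... | no _ = old

-- Split the subset sum defining q according to whether a ∈ S. The weights of a enter the
-- term of S only through the single factor α(a) or β(a), so every S ∋ a contributes r₁ times
-- its old term. For S ∌ a the induced subgraphs G[S] and (G − a)[S] coincide, so rank and
-- nullity are unchanged, and the factor r₁β(a) + r₂ splits the term of S into r₁ times its
-- old term plus r₂ times the term of S in q(G − a).
module Submission where

open import Defs
open import Level using (Level)
open import Data.Nat using (ℕ; suc)
open import Data.Fin using (Fin)
open import Algebra.Bundles using (CommutativeRing)

open import Algebra.Bundles using (CommutativeMonoid)
open import Data.Bool using (Bool; true; false; _∧_; _∨_; not; if_then_else_)
open import Data.Bool.Properties
  using (∧-comm; ∧-identityʳ; ∧-zeroˡ; ∧-commutativeMonoid; ∨-commutativeMonoid; xor-∧-commutativeRing)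
open import Data.Empty using (⊥-elim)
open import Data.Fin using (zero; suc; punchIn; _≟_)
open import Data.Fin.Properties using (punchInᵢ≢i)
open import Data.List using (List; []; _∷_; _++_; foldr; map; concatMap; tabulate; allFin)
open import Data.List.Properties using (foldr-cong; foldr-map)
import Data.Nat as ℕ
open import Data.Nat using (_⊔_; _∸_)
open import Data.Nat.Properties using (⊔-identityʳ; ⊔-0-commutativeMonoid; +-0-commutativeMonoid)
open import Data.Vec.Functional using (Vector; insertAt; removeAt)
open import Data.Vec.Functional.Properties using (insertAt-lookup; insertAt-punchIn)
open import Relation.Binary.PropositionalEquality as ≡ using (_≡_; _≗_)
open import Relation.Nullary using (yes; no)

module _ {a} {X : Set a} where

  insertAt-cong : ∀ {n} {xs ys : Vector X n} (i : Fin (suc n)) (v : X) →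
                  xs ≗ ys → insertAt xs i v ≗ insertAt ys i v
  insertAt-cong         zero    v xs≗ys zero    = ≡.refl
  insertAt-cong         zero    v xs≗ys (suc j) = xs≗ys j
  insertAt-cong {suc n} (suc i) v xs≗ys zero    = xs≗ys zero
  insertAt-cong {suc n} (suc i) v xs≗ys (suc j) = insertAt-cong i v (λ k → xs≗ys (suc k)) j

  insertAt-suc-insertAt-zero : ∀ {n} (xs : Vector X n) (i : Fin (suc n)) (v w : X) →
    insertAt (insertAt xs zero w) (suc i) v ≗ insertAt (insertAt xs i v) zero w
  insertAt-suc-insertAt-zero xs i v w zero    = ≡.refl
  insertAt-suc-insertAt-zero xs i v w (suc j) = ≡.refl

Subset : ℕ → Set
Subset n = Fin n → Bool

module BigOperators {c ℓ : Level} (M : CommutativeMonoid c ℓ) where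
  open CommutativeMonoid M
  open import Algebra.Definitions _≈_ using (LeftZero)
  open import Algebra.Properties.CommutativeSemigroup commutativeSemigroup using (interchange)
  open import Algebra.Properties.CommutativeMonoid.Sum M using (sum; sum-remove; sum-cong-≋)
  open import Relation.Binary.Reasoning.Setoid setoid

  sumOver : ∀ {x} {X : Set x} → List X → (X → Carrier) → Carrier
  sumOver l F = foldr _∙_ ε (map F l)

  module _ {x} {X : Set x} where

    sumOver-cong : ∀ (l : List X) {F G : X → Carrier} → (∀ u → F u ≈ G u) →
                   sumOver l F ≈ sumOver l G
    sumOver-cong []      F≈G = refl
    sumOver-cong (u ∷ l) F≈G = ∙-cong (F≈G u) (sumOver-cong l F≈G)

    sumOver-ε : ∀ (l : List X) {F : X → Carrier} → (∀ u → F u ≈ ε) → sumOver l F ≈ ε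
    sumOver-ε []      F≈ε = refl
    sumOver-ε (u ∷ l) F≈ε = trans (∙-cong (F≈ε u) (sumOver-ε l F≈ε)) (identityˡ ε)

    sumOver-∙ : ∀ (l : List X) (F G : X → Carrier) →
                sumOver l (λ u → F u ∙ G u) ≈ sumOver l F ∙ sumOver l G
    sumOver-∙ []      F G = sym (identityˡ ε)
    sumOver-∙ (u ∷ l) F G = trans (∙-cong refl (sumOver-∙ l F G)) (interchange _ _ _ _)

    sumOver-++ : ∀ (l l' : List X) (F : X → Carrier) →
                 sumOver (l ++ l') F ≈ sumOver l F ∙ sumOver l' F
    sumOver-++ []      l' F = sym (identityˡ _)
    sumOver-++ (u ∷ l) l' F = trans (∙-cong refl (sumOver-++ l l' F)) (sym (assoc _ _ _))

  sumOver-concatMap : ∀ {x y} {X : Set x} {Y : Set y} (k : X → List Y) (l : List X) (F : Y → Carrier) →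
                      sumOver (concatMap k l) F ≈ sumOver l (λ u → sumOver (k u) F)
  sumOver-concatMap k []      F = refl
  sumOver-concatMap k (u ∷ l) F = begin
    sumOver (k u ++ concatMap k l) F                   ≈⟨ sumOver-++ (k u) (concatMap k l) F ⟩
    sumOver (k u) F ∙ sumOver (concatMap k l) F        ≈⟨ ∙-cong refl (sumOver-concatMap k l F) ⟩
    sumOver (k u) F ∙ sumOver l (λ v → sumOver (k v) F) ∎

  sumSubsets : ∀ n → (Subset n → Carrier) → Carrier
  sumSubsets n = sumOver (subsets n)

  Respects≗ : ∀ {n} → (Subset n → Carrier) → Set ℓ
  Respects≗ {n} F = ∀ {S S' : Subset n} → S ≗ S' → F S ≈ F S'

  -- `subsets` builds its elements with a local cons that agrees with `insertAt _ zero`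
  -- only pointwise; this is why the summands are required to respect ≗.
  sumSubsets-zero : ∀ n (F : Subset (suc n) → Carrier) → Respects≗ F →
    sumSubsets (suc n) F ≈
      sumSubsets n (λ T → F (insertAt T zero false)) ∙ sumSubsets n (λ T → F (insertAt T zero true))
  sumSubsets-zero n F resp = begin
    sumSubsets (suc n) F
      ≈⟨ trans (sumOver-concatMap _ (subsets n) F)
               (sumOver-cong (subsets n) λ T →
                  ∙-cong (resp (λ { zero → ≡.refl ; (suc i) → ≡.refl }))
                         (trans (identityʳ _) (resp (λ { zero → ≡.refl ; (suc i) → ≡.refl })))) ⟩
    sumOver (subsets n) (λ T → F (insertAt T zero false) ∙ F (insertAt T zero true))
      ≈⟨ sumOver-∙ (subsets n) _ _ ⟩
    sumSubsets n (λ T → F (insertAt T zero false)) ∙ sumSubsets n (λ T → F (insertAt T zero true)) ∎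

  sumSubsets-insertAt : ∀ {n} (a : Fin (suc n)) (F : Subset (suc n) → Carrier) → Respects≗ F →
    sumSubsets (suc n) F ≈
      sumSubsets n (λ T → F (insertAt T a false)) ∙ sumSubsets n (λ T → F (insertAt T a true))
  sumSubsets-insertAt {n}     zero    F resp = sumSubsets-zero n F resp
  sumSubsets-insertAt {suc n} (suc a) F resp = begin
    sumSubsets (suc (suc n)) F
      ≈⟨ sumSubsets-zero (suc n) F resp ⟩
    sumSubsets (suc n) (F₀ false) ∙ sumSubsets (suc n) (F₀ true)
      ≈⟨ ∙-cong (sumSubsets-insertAt a (F₀ false) (resp₀ false))
                (sumSubsets-insertAt a (F₀ true) (resp₀ true)) ⟩
    (Σ false false ∙ Σ false true) ∙ (Σ true false ∙ Σ true true)
      ≈⟨ interchange _ _ _ _ ⟩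
    (Σ false false ∙ Σ true false) ∙ (Σ false true ∙ Σ true true)
      ≈⟨ sym (∙-cong (commute false) (commute true)) ⟩
    sumSubsets (suc n) (Fₐ false) ∙ sumSubsets (suc n) (Fₐ true) ∎
    where
    F₀ : Bool → Subset (suc n) → Carrier
    F₀ c T = F (insertAt T zero c)
    Fₐ : Bool → Subset (suc n) → Carrier
    Fₐ b T = F (insertAt T (suc a) b)
    Σ : Bool → Bool → Carrier
    Σ c b = sumSubsets n (λ T → F (insertAt (insertAt T a b) zero c))
    resp₀ : ∀ c → Respects≗ (F₀ c)
    resp₀ c T≗T' = resp (insertAt-cong zero c T≗T')
    respₐ : ∀ b → Respects≗ (Fₐ b)
    respₐ b T≗T' = resp (insertAt-cong (suc a) b T≗T')
    commute : ∀ b → sumSubsets (suc n) (Fₐ b) ≈ Σ false b ∙ Σ true b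
    commute b = trans (sumSubsets-zero n (Fₐ b) (respₐ b))
      (∙-cong (sumOver-cong (subsets n) λ T → resp (insertAt-suc-insertAt-zero T a b false))
              (sumOver-cong (subsets n) λ T → resp (insertAt-suc-insertAt-zero T a b true)))

  foldFin : ∀ n → (Fin n → Carrier) → Carrier
  foldFin n f = foldr (λ i acc → f i ∙ acc) ε (allFin n)

  foldFin≡sum : ∀ n (f : Fin n → Carrier) → foldFin n f ≡ sum f
  foldFin≡sum n f = foldr-tabulate (λ i → i)
    where
    foldr-tabulate : ∀ {k} (g : Fin k → Fin n) →
                     foldr (λ i acc → f i ∙ acc) ε (tabulate g) ≡ sum (λ j → f (g j))
    foldr-tabulate {ℕ.zero} g = ≡.refl
    foldr-tabulate {suc k} g = ≡.cong (f (g zero) ∙_) (foldr-tabulate (λ j → g (suc j)))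

  foldFin-cong : ∀ n {f g : Fin n → Carrier} → (∀ i → f i ≈ g i) → foldFin n f ≈ foldFin n g
  foldFin-cong n {f} {g} f≈g = begin
    foldFin n f ≡⟨ foldFin≡sum n f ⟩
    sum f       ≈⟨ sum-cong-≋ f≈g ⟩
    sum g       ≡⟨ foldFin≡sum n g ⟨
    foldFin n g ∎

  foldFin-removeAt : ∀ {m} (a : Fin (suc m)) (f : Fin (suc m) → Carrier) →
                     foldFin (suc m) f ≈ f a ∙ foldFin m (removeAt f a)
  foldFin-removeAt {m} a f = begin
    foldFin (suc m) f             ≡⟨ foldFin≡sum (suc m) f ⟩
    sum f                         ≈⟨ sum-remove f ⟩
    f a ∙ sum (removeAt f a)      ≡⟨ ≡.cong (f a ∙_) (foldFin≡sum m (removeAt f a)) ⟨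
    f a ∙ foldFin m (removeAt f a) ∎

  foldFin-punchIn : ∀ {m} (a : Fin (suc m)) (f : Fin (suc m) → Carrier) {g : Fin m → Carrier} →
                    f a ≈ ε → (∀ i → f (punchIn a i) ≈ g i) → foldFin (suc m) f ≈ foldFin m g
  foldFin-punchIn a f fa≈ε f∘punchIn≈g =
    trans (foldFin-removeAt a f)
          (trans (∙-cong fa≈ε (foldFin-cong _ f∘punchIn≈g)) (identityˡ _))

  foldFin-leftZero : ∀ {m z} → LeftZero z _∙_ → (a : Fin (suc m)) (f : Fin (suc m) → Carrier) →
                     f a ≈ z → foldFin (suc m) f ≈ z
  foldFin-leftZero zeroˡ a f fa≈z = trans (foldFin-removeAt a f) (trans (∙-cong fa≈z refl) (zeroˡ _))

  foldFin-insertAt-ε : ∀ {m} (a : Fin (suc m)) (f : Fin m → Carrier) →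
                       foldFin (suc m) (insertAt f a ε) ≈ foldFin m f
  foldFin-insertAt-ε a f =
    foldFin-punchIn a _ (reflexive (insertAt-lookup f a ε)) (λ i → reflexive (insertAt-punchIn f a ε i))

module All   = BigOperators ∧-commutativeMonoid
module Any   = BigOperators ∨-commutativeMonoid
module Xor   = BigOperators (CommutativeRing.+-commutativeMonoid xor-∧-commutativeRing)
module Max   = BigOperators ⊔-0-commutativeMonoid
module Count = BigOperators +-0-commutativeMonoid

card≡count : ∀ n (S : Subset n) → card n S ≡ Count.foldFin n (λ i → if S i then 1 else 0)
card≡count n S = foldr-cong (λ i k → if-suc (S i) k) ≡.refl (allFin n)
  where
  if-suc : ∀ b k → (if b then suc k else k) ≡ (if b then 1 else 0) ℕ.+ k
  if-suc true  k = ≡.refl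
  if-suc false k = ≡.refl

card-cong : ∀ n {S S' : Subset n} → S ≗ S' → card n S ≡ card n S'
card-cong n S≗S' = foldr-cong (λ i k → ≡.cong (λ b → if b then suc k else k) (S≗S' i)) ≡.refl (allFin n)

card-insertAt-false : ∀ {m} (a : Fin (suc m)) (T : Subset m) → card (suc m) (insertAt T a false) ≡ card m T
card-insertAt-false {m} a T = begin
  card (suc m) (insertAt T a false)                                  ≡⟨ card≡count (suc m) _ ⟩
  Count.foldFin (suc m) (λ i → if insertAt T a false i then 1 else 0) ≡⟨ Count.foldFin-punchIn a _
      (≡.cong (if_then 1 else 0) (insertAt-lookup T a false))
      (λ i → ≡.cong (if_then 1 else 0) (insertAt-punchIn T a false i)) ⟩
  Count.foldFin m (λ i → if T i then 1 else 0)                       ≡⟨ card≡count m T ⟨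
  card m T ∎
  where open ≡.≡-Reasoning

_⊆ᵇ_ : ∀ {n} → Subset n → Subset n → Bool
_⊆ᵇ_ {n} U T = allV n (λ i → not (U i) ∨ T i)

⊆ᵇ-cong : ∀ {n} {U U' T T' : Subset n} → U ≗ U' → T ≗ T' → (U ⊆ᵇ T) ≡ (U' ⊆ᵇ T')
⊆ᵇ-cong {n} U≗U' T≗T' = All.foldFin-cong n (λ i → ≡.cong₂ (λ u t → not u ∨ t) (U≗U' i) (T≗T' i))

⊆ᵇ-insertAt-false : ∀ {m} (a : Fin (suc m)) (b : Bool) (U T : Subset m) →
                    (insertAt U a false ⊆ᵇ insertAt T a b) ≡ (U ⊆ᵇ T)
⊆ᵇ-insertAt-false a b U T = All.foldFin-punchIn a _
  (≡.cong (λ u → not u ∨ insertAt T a b a) (insertAt-lookup U a false))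
  (λ i → ≡.cong₂ (λ u t → not u ∨ t) (insertAt-punchIn U a false i) (insertAt-punchIn T a b i))

⊆ᵇ-insertAt-true : ∀ {m} (a : Fin (suc m)) (U T : Subset m) →
                   (insertAt U a true ⊆ᵇ insertAt T a false) ≡ false
⊆ᵇ-insertAt-true a U T = All.foldFin-leftZero ∧-zeroˡ a _
  (≡.cong₂ (λ u t → not u ∨ t) (insertAt-lookup U a true) (insertAt-lookup T a false))

rowSumNonzeroOn : ∀ {n} → Graph n → Subset n → Subset n → Bool
rowSumNonzeroOn {n} G S U = anyV n (λ j → S j ∧ xorV n (λ i → U i ∧ adj G i j))

rowSumNonzeroOn-cong : ∀ {n} (G : Graph n) {S S' U U' : Subset n} → S ≗ S' → U ≗ U' →
                       rowSumNonzeroOn G S U ≡ rowSumNonzeroOn G S' U'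
rowSumNonzeroOn-cong {n} G S≗S' U≗U' = Any.foldFin-cong n λ j →
  ≡.cong₂ _∧_ (S≗S' j) (Xor.foldFin-cong n λ i → ≡.cong (_∧ adj G i j) (U≗U' i))

notDependency : ∀ {n} → Graph n → (S T U : Subset n) → Bool
notDependency {n} G S T U = not (U ⊆ᵇ T) ∨ not (anyV n U) ∨ rowSumNonzeroOn G S U

notDependency-cong : ∀ {n} (G : Graph n) {S S' T T' U U' : Subset n} → S ≗ S' → T ≗ T' → U ≗ U' →
                     notDependency G S T U ≡ notDependency G S' T' U'
notDependency-cong {n} G S≗S' T≗T' U≗U' =
  ≡.cong₂ _∨_ (≡.cong not (⊆ᵇ-cong U≗U' T≗T'))
    (≡.cong₂ _∨_ (≡.cong not (Any.foldFin-cong n U≗U')) (rowSumNonzeroOn-cong G S≗S' U≗U'))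

rowsIndependent≡sumSubsets : ∀ {n} (G : Graph n) (S T : Subset n) →
                             rowsIndependent G S T ≡ All.sumSubsets n (notDependency G S T)
rowsIndependent≡sumSubsets {n} G S T = ≡.trans
  (foldr-cong (λ U b → ∧-comm b (notDependency G S T U)) ≡.refl (subsets n))
  (≡.sym (foldr-map _∧_ (notDependency G S T) true (subsets n)))

rowsIndependent-cong : ∀ {n} (G : Graph n) {S S' T T' : Subset n} → S ≗ S' → T ≗ T' →
                       rowsIndependent G S T ≡ rowsIndependent G S' T'
rowsIndependent-cong {n} G {S} {S'} {T} {T'} S≗S' T≗T' = begin
  rowsIndependent G S T                      ≡⟨ rowsIndependent≡sumSubsets G S T ⟩
  All.sumSubsets n (notDependency G S T)     ≡⟨ All.sumOver-cong (subsets n) (λ U →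
                                                  notDependency-cong G S≗S' T≗T' (λ _ → ≡.refl)) ⟩
  All.sumSubsets n (notDependency G S' T')   ≡⟨ rowsIndependent≡sumSubsets G S' T' ⟨
  rowsIndependent G S' T'                    ∎
  where open ≡.≡-Reasoning

independentSize : ∀ {n} → Graph n → Subset n → Subset n → ℕ
independentSize {n} G S T = if T ⊆ᵇ S ∧ rowsIndependent G S T then card n T else 0

independentSize-cong : ∀ {n} (G : Graph n) {S S' T T' : Subset n} → S ≗ S' → T ≗ T' →
                       independentSize G S T ≡ independentSize G S' T'
independentSize-cong {n} G S≗S' T≗T' =
  ≡.cong₂ (λ b k → if b then k else 0)
    (≡.cong₂ _∧_ (⊆ᵇ-cong T≗T' S≗S') (rowsIndependent-cong G S≗S' T≗T'))
    (card-cong n T≗T')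

rankOn-cong : ∀ {n} (G : Graph n) {S S' : Subset n} → S ≗ S' → rankOn G S ≡ rankOn G S'
rankOn-cong {n} G S≗S' = Max.sumOver-cong (subsets n) λ T → independentSize-cong G S≗S' (λ _ → ≡.refl)

nullityOn-cong : ∀ {n} (G : Graph n) {S S' : Subset n} → S ≗ S' → nullityOn G S ≡ nullityOn G S'
nullityOn-cong {n} G S≗S' = ≡.cong₂ _∸_ (card-cong n S≗S') (rankOn-cong G S≗S')

-- For S ∌ a only row sets avoiding a count: a row set containing a is not inside S, and a
-- dependency containing a is not inside a row set avoiding a. On such sets G and G − a agree.
module _ {m} (G : Graph (suc m)) (a : Fin (suc m)) where

  rowSumNonzeroOn-deleteG : ∀ (T W : Subset m) →
    rowSumNonzeroOn G (insertAt T a false) (insertAt W a false) ≡ rowSumNonzeroOn (deleteG G a) T W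
  rowSumNonzeroOn-deleteG T W = Any.foldFin-punchIn a _
    (≡.cong (_∧ _) (insertAt-lookup T a false))
    (λ j → ≡.cong₂ _∧_ (insertAt-punchIn T a false j) (Xor.foldFin-punchIn a
       (λ i → insertAt W a false i ∧ adj G i (punchIn a j))
       (≡.cong (_∧ adj G a (punchIn a j)) (insertAt-lookup W a false))
       (λ i → ≡.cong (_∧ adj G (punchIn a i) (punchIn a j)) (insertAt-punchIn W a false i))))

  notDependency-insertAt-true : ∀ (T U W : Subset m) →
    notDependency G (insertAt T a false) (insertAt U a false) (insertAt W a true) ≡ true
  notDependency-insertAt-true T U W = ≡.cong (λ s → not s ∨ _) (⊆ᵇ-insertAt-true a W U)

  notDependency-insertAt-false : ∀ (T U W : Subset m) →
    notDependency G (insertAt T a false) (insertAt U a false) (insertAt W a false)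
      ≡ notDependency (deleteG G a) T U W
  notDependency-insertAt-false T U W =
    ≡.cong₂ _∨_ (≡.cong not (⊆ᵇ-insertAt-false a false W U))
      (≡.cong₂ _∨_ (≡.cong not (Any.foldFin-insertAt-ε a W))
                   (rowSumNonzeroOn-deleteG T W))

  rowsIndependent-deleteG : ∀ (T U : Subset m) →
    rowsIndependent G (insertAt T a false) (insertAt U a false) ≡ rowsIndependent (deleteG G a) T U
  rowsIndependent-deleteG T U = begin
    rowsIndependent G S U⁺
      ≡⟨ rowsIndependent≡sumSubsets G S U⁺ ⟩
    All.sumSubsets (suc m) (notDependency G S U⁺)
      ≡⟨ All.sumSubsets-insertAt a (notDependency G S U⁺) (notDependency-cong G (λ _ → ≡.refl) (λ _ → ≡.refl)) ⟩
    All.sumSubsets m (λ W → notDependency G S U⁺ (insertAt W a false))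
      ∧ All.sumSubsets m (λ W → notDependency G S U⁺ (insertAt W a true))
      ≡⟨ ≡.cong₂ _∧_ (All.sumOver-cong (subsets m) (notDependency-insertAt-false T U))
                     (All.sumOver-ε (subsets m) (notDependency-insertAt-true T U)) ⟩
    All.sumSubsets m (notDependency (deleteG G a) T U) ∧ true
      ≡⟨ ∧-identityʳ _ ⟩
    All.sumSubsets m (notDependency (deleteG G a) T U)
      ≡⟨ rowsIndependent≡sumSubsets (deleteG G a) T U ⟨
    rowsIndependent (deleteG G a) T U ∎
    where
    open ≡.≡-Reasoning
    S U⁺ : Subset (suc m)
    S  = insertAt T a false
    U⁺ = insertAt U a false

  independentSize-insertAt-true : ∀ (T U : Subset m) →
    independentSize G (insertAt T a false) (insertAt U a true) ≡ 0
  independentSize-insertAt-true T U =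
    ≡.cong (λ b → if b ∧ rowsIndependent G S U⁺ then card (suc m) U⁺ else 0) (⊆ᵇ-insertAt-true a U T)
    where
    S U⁺ : Subset (suc m)
    S  = insertAt T a false
    U⁺ = insertAt U a true

  independentSize-insertAt-false : ∀ (T U : Subset m) →
    independentSize G (insertAt T a false) (insertAt U a false) ≡ independentSize (deleteG G a) T U
  independentSize-insertAt-false T U =
    ≡.cong₂ (λ b k → if b then k else 0)
      (≡.cong₂ _∧_ (⊆ᵇ-insertAt-false a false U T) (rowsIndependent-deleteG T U))
      (card-insertAt-false a U)

  rankOn-deleteG : ∀ (T : Subset m) → rankOn G (insertAt T a false) ≡ rankOn (deleteG G a) T
  rankOn-deleteG T = begin
    rankOn G S
      ≡⟨ Max.sumSubsets-insertAt a (independentSize G S) (independentSize-cong G (λ _ → ≡.refl)) ⟩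
    Max.sumSubsets m (λ U → independentSize G S (insertAt U a false))
      ⊔ Max.sumSubsets m (λ U → independentSize G S (insertAt U a true))
      ≡⟨ ≡.cong₂ _⊔_ (Max.sumOver-cong (subsets m) (independentSize-insertAt-false T))
                     (Max.sumOver-ε (subsets m) (independentSize-insertAt-true T)) ⟩
    rankOn (deleteG G a) T ⊔ 0
      ≡⟨ ⊔-identityʳ _ ⟩
    rankOn (deleteG G a) T ∎
    where
    open ≡.≡-Reasoning
    S : Subset (suc m)
    S = insertAt T a false

  nullityOn-deleteG : ∀ (T : Subset m) → nullityOn G (insertAt T a false) ≡ nullityOn (deleteG G a) T
  nullityOn-deleteG T = ≡.cong₂ _∸_ (card-insertAt-false a T) (rankOn-deleteG T)

module Expansion {c ℓ : Level} (A : CommutativeRing c ℓ) (x y : CommutativeRing.Carrier A) where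
  open CommutativeRing A
  open import Relation.Binary.Reasoning.Setoid setoid
  module Σ = BigOperators +-commutativeMonoid
  module Π = BigOperators *-commutativeMonoid

  sumOver-distribˡ : ∀ {z} {Z : Set z} (l : List Z) (r : Carrier) (F : Z → Carrier) →
                     Σ.sumOver l (λ u → r * F u) ≈ r * Σ.sumOver l F
  sumOver-distribˡ []      r F = sym (zeroʳ r)
  sumOver-distribˡ (u ∷ l) r F = trans (+-cong refl (sumOver-distribˡ l r F)) (sym (distribˡ r _ _))

  weight : ∀ {n} → WGraph A n → Fin n → Bool → Carrier
  weight G v b = if b then α G v else β G v

  weightProduct : ∀ {n} → WGraph A n → Subset n → Carrier
  weightProduct {n} G S = prodV A n (λ v → weight G v (S v))

  rankFactor : ∀ {n} → Graph n → Subset n → Carrier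
  rankFactor Γ S = pow A (x - 1#) (rankOn Γ S) * pow A (y - 1#) (nullityOn Γ S)

  rankFactor-cong : ∀ {n} (Γ : Graph n) {S S' : Subset n} → S ≗ S' → rankFactor Γ S ≡ rankFactor Γ S'
  rankFactor-cong Γ S≗S' = ≡.cong₂ (λ r k → pow A (x - 1#) r * pow A (y - 1#) k)
                                   (rankOn-cong Γ S≗S') (nullityOn-cong Γ S≗S')

  rankFactor-deleteG : ∀ {m} (Γ : Graph (suc m)) (a : Fin (suc m)) (T : Subset m) →
                       rankFactor Γ (insertAt T a false) ≡ rankFactor (deleteG Γ a) T
  rankFactor-deleteG Γ a T = ≡.cong₂ (λ r k → pow A (x - 1#) r * pow A (y - 1#) k)
                                     (rankOn-deleteG Γ a T) (nullityOn-deleteG Γ a T)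

  term : ∀ {n} → WGraph A n → Subset n → Carrier
  term G S = weightProduct G S * rankFactor (graph G) S

  q≈sumSubsets : ∀ {n} (G : WGraph A n) → q A x y G ≈ Σ.sumSubsets n (term G)
  q≈sumSubsets {n} G = Σ.sumOver-cong (subsets n) λ S → *-assoc _ _ _

  term-cong : ∀ {n} (G : WGraph A n) → Σ.Respects≗ (term G)
  term-cong {n} G S≗S' = *-cong
    (Π.foldFin-cong n λ v → reflexive (≡.cong (weight G v) (S≗S' v)))
    (reflexive (rankFactor-cong (graph G) S≗S'))

  weightProduct-insertAt : ∀ {m} (G : WGraph A (suc m)) (a : Fin (suc m)) (T : Subset m) (b : Bool) →
    weightProduct G (insertAt T a b) ≈ weight G a b * weightProduct (deleteW A G a) T
  weightProduct-insertAt {m} G a T b = trans (Π.foldFin-removeAt a _)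
    (*-cong (reflexive (≡.cong (weight G a) (insertAt-lookup T a b)))
            (Π.foldFin-cong m λ i → reflexive (≡.cong (weight G (punchIn a i)) (insertAt-punchIn T a b i))))

  term-insertAt : ∀ {m} (G : WGraph A (suc m)) (a : Fin (suc m)) (T : Subset m) (b : Bool) →
    term G (insertAt T a b) ≈
      weight G a b * (weightProduct (deleteW A G a) T * rankFactor (graph G) (insertAt T a b))
  term-insertAt G a T b = trans (*-cong (weightProduct-insertAt G a T b) refl) (*-assoc _ _ _)

  module Reweighting {m} (G : WGraph A (suc m)) (a : Fin (suc m)) (r₁ r₂ : Carrier) where
    G′ : WGraph A (suc m)
    G′ = reweight A G a r₁ r₂

    G-a : WGraph A m
    G-a = deleteW A G a

    α′-at : α G′ a ≡ r₁ * α G a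
    α′-at with a ≟ a
    ... | yes _  = ≡.refl
    ... | no a≢a = ⊥-elim (a≢a ≡.refl)

    β′-at : β G′ a ≡ r₁ * β G a + r₂
    β′-at with a ≟ a
    ... | yes _  = ≡.refl
    ... | no a≢a = ⊥-elim (a≢a ≡.refl)

    weight′-punchIn : ∀ i b → weight G′ (punchIn a i) b ≡ weight G (punchIn a i) b
    weight′-punchIn i b with punchIn a i ≟ a
    ... | yes pᵢ≡a = ⊥-elim (punchInᵢ≢i a i pᵢ≡a)
    ... | no _     = ≡.refl

    weightProduct′-delete : ∀ T → weightProduct (deleteW A G′ a) T ≈ weightProduct G-a T
    weightProduct′-delete T = Π.foldFin-cong m λ i → reflexive (weight′-punchIn i (T i))

    term′-insertAt-true : ∀ T → term G′ (insertAt T a true) ≈ r₁ * term G (insertAt T a true)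
    term′-insertAt-true T = begin
      term G′ (insertAt T a true)
        ≈⟨ term-insertAt G′ a T true ⟩
      α G′ a * (weightProduct (deleteW A G′ a) T * F)
        ≈⟨ *-cong (reflexive α′-at) (*-cong (weightProduct′-delete T) refl) ⟩
      (r₁ * α G a) * (weightProduct G-a T * F)
        ≈⟨ *-assoc _ _ _ ⟩
      r₁ * (α G a * (weightProduct G-a T * F))
        ≈⟨ *-cong refl (term-insertAt G a T true) ⟨
      r₁ * term G (insertAt T a true) ∎
      where
      F : Carrier
      F = rankFactor (graph G) (insertAt T a true)

    term′-insertAt-false : ∀ T →
      term G′ (insertAt T a false) ≈ r₁ * term G (insertAt T a false) + r₂ * term G-a T
    term′-insertAt-false T = begin
      term G′ (insertAt T a false)
        ≈⟨ term-insertAt G′ a T false ⟩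
      β G′ a * (weightProduct (deleteW A G′ a) T * F)
        ≈⟨ *-cong (reflexive β′-at) (*-cong (weightProduct′-delete T) (reflexive (rankFactor-deleteG (graph G) a T))) ⟩
      (r₁ * β G a + r₂) * term G-a T
        ≈⟨ distribʳ _ _ _ ⟩
      (r₁ * β G a) * term G-a T + r₂ * term G-a T
        ≈⟨ +-cong (*-assoc _ _ _) refl ⟩
      r₁ * (β G a * term G-a T) + r₂ * term G-a T
        ≈⟨ +-cong (*-cong refl (*-cong refl (*-cong refl (reflexive (rankFactor-deleteG (graph G) a T))))) refl ⟨
      r₁ * (β G a * (weightProduct G-a T * F)) + r₂ * term G-a T
        ≈⟨ +-cong (*-cong refl (term-insertAt G a T false)) refl ⟨
      r₁ * term G (insertAt T a false) + r₂ * term G-a T ∎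
      where
      F : Carrier
      F = rankFactor (graph G) (insertAt T a false)

proposition1 : {c ℓ : Level} (A : CommutativeRing c ℓ)
    (x y : CommutativeRing.Carrier A) {m : ℕ} (G : WGraph A (suc m)) (a : Fin (suc m))
    (r₁ r₂ : CommutativeRing.Carrier A) →
    CommutativeRing._≈_ A (q A x y (reweight A G a r₁ r₂))
      (CommutativeRing._+_ A (CommutativeRing._*_ A r₁ (q A x y G))
        (CommutativeRing._*_ A r₂ (q A x y (deleteW A G a))))
proposition1 A x y {m} G a r₁ r₂ = begin
  q A x y G′
    ≈⟨ trans (q≈sumSubsets G′) (Σ.sumSubsets-insertAt a (term G′) (term-cong G′)) ⟩
  Σ.sumSubsets m (λ T → term G′ (insertAt T a false)) + Σ.sumSubsets m (λ T → term G′ (insertAt T a true))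
    ≈⟨ +-cong (Σ.sumOver-cong (subsets m) term′-insertAt-false) (Σ.sumOver-cong (subsets m) term′-insertAt-true) ⟩
  Σ.sumSubsets m (λ T → r₁ * t∉ T + r₂ * term G-a T) + Σ.sumSubsets m (λ T → r₁ * t∈ T)
    ≈⟨ +-cong (trans (Σ.sumOver-∙ (subsets m) _ _) (+-cong (sumOver-distribˡ (subsets m) r₁ t∉)
                                                          (sumOver-distribˡ (subsets m) r₂ (term G-a))))
              (sumOver-distribˡ (subsets m) r₁ t∈) ⟩
  (r₁ * Σ.sumSubsets m t∉ + r₂ * Σ.sumSubsets m (term G-a)) + r₁ * Σ.sumSubsets m t∈
    ≈⟨ xy∙z≈xz∙y _ _ _ ⟩
  (r₁ * Σ.sumSubsets m t∉ + r₁ * Σ.sumSubsets m t∈) + r₂ * Σ.sumSubsets m (term G-a)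
    ≈⟨ +-cong (distribˡ r₁ _ _) refl ⟨
  r₁ * (Σ.sumSubsets m t∉ + Σ.sumSubsets m t∈) + r₂ * Σ.sumSubsets m (term G-a)
    ≈⟨ +-cong (*-cong refl (trans (q≈sumSubsets G) (Σ.sumSubsets-insertAt a (term G) (term-cong G))))
              (*-cong refl (q≈sumSubsets G-a)) ⟨
  r₁ * q A x y G + r₂ * q A x y G-a ∎
  where
  open CommutativeRing A
  open Expansion A x y
  open Reweighting G a r₁ r₂
  open import Algebra.Properties.CommutativeSemigroup +-commutativeSemigroup using (xy∙z≈xz∙y)
  open import Relation.Binary.Reasoning.Setoid setoid
  t∉ t∈ : Subset m → Carrier
  t∉ T = term G (insertAt T a false)
  t∈ T = term G (insertAt T a true)
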